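{- Let $G=(V,W,E)$ be an $(\ell\times m)$-layered graph with partitions $V=V_0\uplus\dots\uplus V_\ell$ and $W=W_1\uplus\dots\uplus W_\ell$ such that $\deg(w)\le k$ for all $w\in W$. Let $x_\ell\in V_\ell$ and let $\beta_\ell\colon\{x_\ell\}\to\{0,1\}$ be given by $\beta_\ell(x_\ell)=1$. Let $\mathcal C:=\mathcal C_G\cup\{(\{x\},0)\mid x\in V_0\}$. Then Falsifier wins the $k$-pebble game $\mathcal G_k(V,\mathcal C,\beta_\ell)$.
   Context: An $(\ell\times m)$-layered graph is a bipartite graph $G=(V,W,E)$ with partitions $V=V_0\uplus\dots\uplus V_\ell$, $W=W_1\uplus\dots\uplus W_\ell$ such that $|V_i|=|W_j|=m$, $N_G(W_i)\subseteq V_{i-1}\cup V_i$ and $G[V_i\cup W_i]$ is 1-regular for all $i\in[\ell]$. $\mathcal C_G:=\{(N(w),0)\mid w\in W\}$ is a set of XOR-constraints over the variable set $V$. An XOR-constraint $(C,a)$ ($C\subseteq V$, $a\in\{0,1\}$) is violated by a partial assignment $\beta\colon X\to\{0,1\}$ if $C\subseteq X$ and $\sum_{x\in C}\beta(x)\not\equiv a\pmod 2$. The $k$-pebble game $\mathcal G_k(V,\mathcal C,\beta_0)$ starts at position $\beta_0$; in each round at position $\beta\colon X\to\{0,1\}$, Falsifier picks $x\in V\setminus X$ and $X'\subseteq X$ with $|X'\cup\{x\}|\le k$, Verifier picks $b\in\{0,1\}$, and the position becomes $\beta'$ on $X'\cup\{x\}$ with $\beta'|_{X'}=\beta|_{X'}$,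 $\beta'(x)=b$. Falsifier wins if some position (including the initial one) violates a constraint of $\mathcal C$ after finitely many rounds; winning the game means having a winning strategy. -}

module Defs where

open import Data.Bool using (Bool; true; false; if_then_else_; _xor_; _∨_)
open import Data.Nat using (ℕ; suc; _≤_)
import Data.Fin as Fin
open import Data.Fin using (Fin; inject₁; fromℕ) renaming (_≟_ to _≟F_)
open import Data.Product using (Σ; ∃; ∃!; _×_; _,_; proj₁; proj₂)
open import Data.Product.Properties using (≡-dec)
open import Data.Sum using (_⊎_; inj₁; inj₂)
open import Data.Maybe using (Maybe; just; nothing)
open import Data.List using (List; []; _∷_; length; filterᵇ; foldr; map; concatMap; allFin)
open import Relation.Binary.PropositionalEquality using (_≡_; _≢_)
open import Relation.Binary.Definitions using (DecidableEquality)
open import Relation.Nullary.Decidable using (⌊_⌋)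

-- Generic XOR-constraints and the k-pebble game over a finite variable
-- set V, given by an enumeration allV (without duplicates) and
-- decidable equality.

module PebbleGame (V : Set) (_≟_ : DecidableEquality V) (allV : List V) where

  PartialAssignment : Set
  PartialAssignment = V → Maybe Bool

  Subset : Set
  Subset = V → Bool

  XorConstraint : Set
  XorConstraint = Subset × Bool

  _∈dom_ : V → PartialAssignment → Set
  x ∈dom β = β x ≢ nothing

  ∣_∣ : Subset → ℕ
  ∣ S ∣ = length (filterᵇ S allV)

  value : PartialAssignment → V → Bool
  value β x with β x
  ... | just b  = b
  ... | nothing = false

  parity : PartialAssignment → Subset → Bool
  parity β C = foldr (λ x acc → value β x xor acc) false (filterᵇ C allV)

  Violates : PartialAssignment → XorConstraint → Set
  Violates β (C , a) = (∀ x → C x ≡ true → x ∈dom β) × (parity β C ≢ a)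

  update : PartialAssignment → Subset → V → Bool → PartialAssignment
  update β X' x b v =
    if ⌊ v ≟ x ⌋ then just b else (if X' v then β v else nothing)

  -- Inductive:
  -- a winning strategy of Falsifier that wins in finitely many rounds.
  data FalsifierWins (k : ℕ) {I : Set} (𝒞 : I → XorConstraint)
         : PartialAssignment → Set where
    violated : ∀ {β} (i : I) → Violates β (𝒞 i) → FalsifierWins k 𝒞 β
    move     : ∀ {β} (x : V) → β x ≡ nothing
             → (X' : Subset) → (∀ v → X' v ≡ true → v ∈dom β)
             → ∣ (λ v → X' v ∨ ⌊ v ≟ x ⌋) ∣ ≤ k
             → ((b : Bool) → FalsifierWins k 𝒞 (update β X' x b))
             → FalsifierWins k 𝒞 β

-- V = V_0 ⊎ … ⊎ V_ℓ is represented as Fin (suc ℓ) × Fin m  (V_i = {i} × Fin m),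
-- W = W_1 ⊎ … ⊎ W_ℓ is represented as Fin ℓ × Fin m, where the index
-- i : Fin ℓ stands for the layer i+1 of the paper; so V_{(i+1)-1} is the
-- layer inject₁ i and V_{i+1} is the layer suc i.

LV : ℕ → ℕ → Set
LV ℓ m = Fin (suc ℓ) × Fin m

LW : ℕ → ℕ → Set
LW ℓ m = Fin ℓ × Fin m

_≟V_ : ∀ {ℓ m} → DecidableEquality (LV ℓ m)
_≟V_ = ≡-dec _≟F_ _≟F_

allLV : (ℓ m : ℕ) → List (LV ℓ m)
allLV ℓ m = concatMap (λ i → map (λ j → (i , j)) (allFin m)) (allFin (suc ℓ))

Edges : ℕ → ℕ → Set
Edges ℓ m = LW ℓ m → LV ℓ m → Bool

record IsLayered (ℓ m : ℕ) (E : Edges ℓ m) : Set where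
  field
    nbhd : ∀ i a j b → E (i , a) (j , b) ≡ true → (j ≡ inject₁ i) ⊎ (j ≡ Fin.suc i)
    -- G[V_i ∪ W_i] is 1-regular
    regW : ∀ i a → ∃! _≡_ (λ b → E (i , a) (Fin.suc i , b) ≡ true)
    regV : ∀ i b → ∃! _≡_ (λ a → E (i , a) (Fin.suc i , b) ≡ true)

module LayeredGame (ℓ m : ℕ) = PebbleGame (LV ℓ m) _≟V_ (allLV ℓ m)

deg : ∀ {ℓ m} → Edges ℓ m → LW ℓ m → ℕ
deg {ℓ} {m} E w = LayeredGame.∣_∣ ℓ m (E w)

constraints : ∀ {ℓ m} → Edges ℓ m → LW ℓ m ⊎ Fin m → LayeredGame.XorConstraint ℓ m
constraints E (inj₁ w) = (E w , false)
constraints E (inj₂ j) = ((λ v → ⌊ v ≟V (Fin.zero , j) ⌋) , false)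

βℓ : ∀ {ℓ m} → Fin m → LayeredGame.PartialAssignment ℓ m
βℓ {ℓ} j v = if ⌊ v ≟V (fromℕ ℓ , j) ⌋ then just true else nothing

{-# OPTIONS --safe #-}
-- Falsifier keeps a pebble carrying 1 and pushes it down one layer per phase. If the 1 sits
-- on v ∈ V_{i+1}, let w ∈ W_{i+1} be the partner of v in the matching G[V_{i+1} ∪ W_{i+1}].
-- Falsifier pebbles N(w), at most k vertices, never lifting a pebble already on N(w). Then
-- either the constraint of w is violated, or another vertex of N(w) carries a 1; as v is the
-- only neighbour of w in V_{i+1}, that vertex lies in V_i. In V_0 a 1 violates a singleton
-- constraint.
module Submission where

open import Defs
open import Data.Bool using (Bool; true; false; T; not; _∧_; _∨_; _xor_)
import Data.Bool as Bool
open import Data.Bool.Properties using (T-≡)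
open import Data.Fin using (Fin; inject₁; fromℕ) renaming (suc to fsuc; zero to fzero)
open import Data.Fin.Induction using (<-weakInduction)
open import Data.List using (List; []; _∷_; map; foldr; concatMap; filterᵇ; allFin; cartesianProduct; _++_)
open import Data.List.Membership.Propositional using (_∈_; find; lose)
import Data.List.Membership.Propositional.Properties as ∈
open import Data.List.Relation.Binary.Sublist.Propositional using (⊆-refl)
open import Data.List.Relation.Binary.Sublist.Propositional.Properties using (filter⁺; length-mono-≤)
open import Data.List.Relation.Unary.All as All using (All; []; _∷_)
open import Data.List.Relation.Unary.Any using (here; there; any?)
open import Data.List.Relation.Unary.AllPairs using (_∷_)
open import Data.List.Relation.Unary.Unique.Propositional using (Unique)
import Data.List.Relation.Unary.Unique.Propositional.Properties as Unique
open import Data.Maybe using (just; nothing; is-just)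
import Data.Maybe.Properties as Maybe
open import Data.Nat using (ℕ; suc; _≤_)
open import Data.Nat.Properties using (≤-trans)
open import Data.Product using (∃; _×_; _,_; proj₁; proj₂)
open import Data.Sum using (_⊎_; inj₁; inj₂; [_,_]′)
open import Function using (_∘_; id; case_of_)
open import Function.Bundles using (Equivalence)
open import Relation.Binary.Definitions using (DecidableEquality)
open import Relation.Binary.PropositionalEquality using (_≡_; _≢_; refl; sym; trans; cong; subst; ≢-sym)
open import Relation.Nullary using (yes; no; ¬?; contradiction)
open import Relation.Nullary.Decidable using (⌊_⌋; _×-dec_)

module EnumeratedPebbleGame (V : Set) (_≟_ : DecidableEquality V) (allV : List V)
                            (allV-unique : Unique allV) (∈-allV : ∀ v → v ∈ allV) where
  open PebbleGame V _≟_ allV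

  ∈-filterᵇ⁺ : ∀ (C : Subset) {v} → C v ≡ true → v ∈ filterᵇ C allV
  ∈-filterᵇ⁺ C {v} Cv = ∈.∈-filter⁺ (Bool.T? ∘ C) (∈-allV v) (Equivalence.from T-≡ Cv)

  ∈-filterᵇ⁻ : ∀ (C : Subset) {v} → v ∈ filterᵇ C allV → C v ≡ true
  ∈-filterᵇ⁻ C v∈ = Equivalence.to T-≡ (proj₂ (∈.∈-filter⁻ (Bool.T? ∘ C) {xs = allV} v∈))

  ∣∣-mono : ∀ {S S′ : Subset} → (∀ v → S v ≡ true → S′ v ≡ true) → ∣ S ∣ ≤ ∣ S′ ∣
  ∣∣-mono {S} {S′} S⊆S′ =
    length-mono-≤ (filter⁺ (Bool.T? ∘ S) (Bool.T? ∘ S′) S⊆S′ᵀ (⊆-refl {x = allV}))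
    where
    S⊆S′ᵀ : ∀ {u v} → u ≡ v → T (S u) → T (S′ v)
    S⊆S′ᵀ refl = Equivalence.from T-≡ ∘ S⊆S′ _ ∘ Equivalence.to T-≡

  value-just : ∀ β v {b} → β v ≡ just b → value β v ≡ b
  value-just β v βv rewrite βv = refl

  value-false : ∀ β v → β v ≢ just true → value β v ≡ false
  value-false β v βv≢1 with β v
  ... | just true  = contradiction refl βv≢1
  ... | just false = refl
  ... | nothing    = refl

  xorSum : PartialAssignment → List V → Bool
  xorSum β = foldr (λ x acc → value β x xor acc) false

  xorSum-zeros : ∀ β L → All (λ z → value β z ≡ false) L → xorSum β L ≡ false
  xorSum-zeros β []      []        = refl
  xorSum-zeros β (z ∷ L) (βz ∷ βL) rewrite βz = xorSum-zeros β L βL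

  xorSum-single-one : ∀ β y L → Unique L → y ∈ L → value β y ≡ true
    → (∀ z → z ∈ L → z ≢ y → value β z ≡ false) → xorSum β L ≡ true
  xorSum-single-one β y (y ∷ L) (y∉L ∷ _) (here refl) βy others rewrite βy =
    cong not (xorSum-zeros β L (All.tabulate λ {z} z∈L →
      others z (there z∈L) (≢-sym (All.lookup y∉L z∈L))))
  xorSum-single-one β y (z ∷ L) (z∉L ∷ L-unique) (there y∈L) βy others
    rewrite others z (here refl) (All.lookup z∉L y∈L) =
    xorSum-single-one β y L L-unique y∈L βy (λ v v∈L → others v (there v∈L))

  violates-or-other-one : ∀ β (C : Subset) y → (∀ v → C v ≡ true → v ∈dom β)
    → C y ≡ true → β y ≡ just true
    → Violates β (C , false) ⊎ ∃ λ z → C z ≡ true × z ≢ y × β z ≡ just true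
  violates-or-other-one β C y C⊆dom Cy βy with any? other? allV
    where
    other? = λ z → (C z Bool.≟ true) ×-dec ¬? (z ≟ y) ×-dec Maybe.≡-dec Bool._≟_ (β z) (just true)
  ... | yes other = let z , _ , Pz = find other in inj₂ (z , Pz)
  ... | no ¬other = inj₁ (C⊆dom , λ even → contradiction (trans (sym odd) even) λ ())
    where
    odd : parity β C ≡ true
    odd = xorSum-single-one β y (filterᵇ C allV) (Unique.filter⁺ _ allV-unique)
      (∈-filterᵇ⁺ C Cy) (value-just β y βy) λ z z∈C z≢y →
      value-false β z λ βz → ¬other (lose (∈-allV z) (∈-filterᵇ⁻ C z∈C , z≢y , βz))

  ⌊≟⌋⇒≡ : ∀ {v y} → ⌊ v ≟ y ⌋ ≡ true → v ≡ y
  ⌊≟⌋⇒≡ {v} {y} with v ≟ y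
  ... | yes v≡y = λ _ → v≡y
  ... | no _    = λ ()

  ⌊≟⌋-refl : ∀ v → ⌊ v ≟ v ⌋ ≡ true
  ⌊≟⌋-refl v with v ≟ v
  ... | yes _   = refl
  ... | no v≢v = contradiction refl v≢v

  just⇒∈dom : ∀ β v {b} → β v ≡ just b → v ∈dom β
  just⇒∈dom β v βv v∉dom = case trans (sym βv) v∉dom of λ ()

  _∩dom_ : Subset → PartialAssignment → Subset
  (C ∩dom β) v = C v ∧ is-just (β v)

  ∩dom⊆dom : ∀ C β v → (C ∩dom β) v ≡ true → v ∈dom β
  ∩dom⊆dom C β v Cβv βv≡nothing with C v
  ... | true  = case trans (sym Cβv) (cong is-just βv≡nothing) of λ ()
  ... | false = case Cβv of λ ()

  ∩dom-with⊆ : ∀ C β {r} → C r ≡ true → ∀ v → ((C ∩dom β) v ∨ ⌊ v ≟ r ⌋) ≡ true → C v ≡ true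
  ∩dom-with⊆ C β {r} Cr v with v ≟ r
  ... | yes refl = λ _ → Cr
  ... | no _ with C v
  ...   | true  = λ _ → refl
  ...   | false = λ ()

  update-∩dom : ∀ C β {r b v} → v ≢ r → C v ≡ true → v ∈dom β
    → update β (C ∩dom β) r b v ≡ β v
  update-∩dom C β {r} {v = v} v≢r Cv v∈dom with v ≟ r
  ... | yes v≡r = contradiction v≡r v≢r
  ... | no _ rewrite Cv with β v
  ...   | just _  = refl
  ...   | nothing = contradiction refl v∈dom

  update-∈dom : ∀ β X r b → r ∈dom update β X r b
  update-∈dom β X r b with r ≟ r
  ... | yes _   = λ ()
  ... | no r≢r = contradiction refl r≢r

  update-∩dom-∈dom : ∀ C β {r b v} → C v ≡ true → v ∈dom β → v ∈dom update β (C ∩dom β) r b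
  update-∩dom-∈dom C β {r} {b} {v} Cv v∈dom = case v ≟ r of λ where
    (yes refl) → update-∈dom β (C ∩dom β) r b
    (no v≢r)   → subst (_≢ nothing) (sym (update-∩dom C β {b = b} v≢r Cv v∈dom)) v∈dom

  -- Each move keeps exactly the pebbles already on C and adds one on C, so at most ∣ C ∣
  -- pebbles are ever in play, and the pebble on y is never lifted.
  pebble-subset : ∀ {k I} {𝒞 : I → XorConstraint} {C : Subset} {y b}
    → ∣ C ∣ ≤ k → C y ≡ true
    → (∀ β → β y ≡ just b → (∀ v → C v ≡ true → v ∈dom β) → FalsifierWins k 𝒞 β)
    → ∀ β → β y ≡ just b → FalsifierWins k 𝒞 β
  pebble-subset {k} {𝒞 = 𝒞} {C} {y} {b} ∣C∣≤k Cy covered β βy =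
    go allV β βy (λ v _ → inj₂ (∈-allV v))
    where
    Covered : PartialAssignment → List V → Set
    Covered β R = ∀ v → C v ≡ true → v ∈dom β ⊎ v ∈ R

    skip : ∀ {β r R} → (C r ≡ true → r ∈dom β) → Covered β (r ∷ R) → Covered β R
    skip r∈dom cov v Cv with cov v Cv
    ... | inj₁ v∈dom          = inj₁ v∈dom
    ... | inj₂ (here refl)    = inj₁ (r∈dom Cv)
    ... | inj₂ (there v∈R)    = inj₂ v∈R

    pebble : ∀ {β r R b′} → Covered β (r ∷ R) → Covered (update β (C ∩dom β) r b′) R
    pebble {β} {b′ = b′} cov v Cv with cov v Cv
    ... | inj₁ v∈dom       = inj₁ (update-∩dom-∈dom C β {b = b′} Cv v∈dom)
    ... | inj₂ (here refl) = inj₁ (update-∈dom β (C ∩dom β) v b′)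
    ... | inj₂ (there v∈R) = inj₂ v∈R

    go : ∀ R β → β y ≡ just b → Covered β R → FalsifierWins k 𝒞 β
    go []      β βy cov = covered β βy (λ v Cv → [ id , (λ ()) ]′ (cov v Cv))
    go (r ∷ R) β βy cov with β r in βr
    ... | just _  = go R β βy (skip (λ _ → just⇒∈dom β r βr) cov)
    ... | nothing with C r in Cr
    ...   | false = go R β βy (skip (λ Cr′ → case trans (sym Cr) Cr′ of λ ()) cov)
    ...   | true  =
      move r βr (C ∩dom β) (∩dom⊆dom C β) (≤-trans (∣∣-mono (∩dom-with⊆ C β Cr)) ∣C∣≤k) λ b′ →
        go R _ (trans (update-∩dom C β {b = b′} y≢r Cy (just⇒∈dom β y βy)) βy) (pebble cov)
      where
      y≢r : y ≢ r
      y≢r refl = just⇒∈dom β y βy βr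

  singleton-violated : ∀ {β y} → β y ≡ just true → Violates β ((λ v → ⌊ v ≟ y ⌋) , false)
  singleton-violated {β} {y} βy
    with violates-or-other-one β _ y
           (λ v v≡y → subst (_∈dom β) (sym (⌊≟⌋⇒≡ {v} {y} v≡y)) (just⇒∈dom β y βy))
           (⌊≟⌋-refl y) βy
  ... | inj₁ C-violated = C-violated
  ... | inj₂ (z , z≡y , z≢y , _) = contradiction (⌊≟⌋⇒≡ {z} {y} z≡y) z≢y

concatMap-pairs≡cartesianProduct : ∀ {A B : Set} (xs : List A) (ys : List B)
  → concatMap (λ x → map (x ,_) ys) xs ≡ cartesianProduct xs ys
concatMap-pairs≡cartesianProduct []       ys = refl
concatMap-pairs≡cartesianProduct (x ∷ xs) ys =
  cong (map (x ,_) ys ++_) (concatMap-pairs≡cartesianProduct xs ys)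

allLV≡cartesianProduct : ∀ ℓ m → allLV ℓ m ≡ cartesianProduct (allFin (suc ℓ)) (allFin m)
allLV≡cartesianProduct ℓ m = concatMap-pairs≡cartesianProduct (allFin (suc ℓ)) (allFin m)

allLV-unique : ∀ ℓ m → Unique (allLV ℓ m)
allLV-unique ℓ m = subst Unique (sym (allLV≡cartesianProduct ℓ m))
  (Unique.cartesianProduct⁺ (Unique.allFin⁺ (suc ℓ)) (Unique.allFin⁺ m))

∈-allLV : ∀ {ℓ m} (v : LV ℓ m) → v ∈ allLV ℓ m
∈-allLV {ℓ} {m} (i , j) = subst ((i , j) ∈_) (sym (allLV≡cartesianProduct ℓ m))
  (∈.∈-cartesianProduct⁺ (∈.∈-allFin i) (∈.∈-allFin j))

module _ {ℓ m} {E : Edges ℓ m} (layered : IsLayered ℓ m E) where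
  open IsLayered layered

  partner : Fin ℓ → Fin m → LW ℓ m
  partner i b = i , proj₁ (regV i b)

  partner-adjacent : ∀ i b → E (partner i b) (fsuc i , b) ≡ true
  partner-adjacent i b = proj₁ (proj₂ (regV i b))

  other-neighbour-below : ∀ {i a b j c} → E (i , a) (fsuc i , b) ≡ true → E (i , a) (j , c) ≡ true
    → (j , c) ≢ (fsuc i , b) → j ≡ inject₁ i
  other-neighbour-below {i} {a} Eb Ec jc≢ib with nbhd i a _ _ Ec
  ... | inj₁ j≡i = j≡i
  ... | inj₂ refl = contradiction (cong (fsuc i ,_) (trans (sym (unique Ec)) (unique Eb))) jc≢ib
    where
    unique = proj₂ (proj₂ (regW i a))

module _ {ℓ m k} {E : Edges ℓ m} (layered : IsLayered ℓ m E) (deg≤k : ∀ w → deg E w ≤ k) where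
  open LayeredGame ℓ m
  open EnumeratedPebbleGame (LV ℓ m) _≟V_ (allLV ℓ m) (allLV-unique ℓ m) ∈-allLV

  OneInLayer : Fin (suc ℓ) → Set
  OneInLayer p = ∀ b β → β (p , b) ≡ just true → FalsifierWins k (constraints E) β

  one-in-layer-zero : OneInLayer fzero
  one-in-layer-zero b β βy = violated (inj₂ b) (singleton-violated βy)

  one-in-layer-suc : ∀ i → OneInLayer (inject₁ i) → OneInLayer (fsuc i)
  one-in-layer-suc i one-below b = pebble-subset (deg≤k w) (partner-adjacent layered i b) covered
    where
    w = partner layered i b
    covered : ∀ β → β (fsuc i , b) ≡ just true → (∀ v → E w v ≡ true → v ∈dom β)
      → FalsifierWins k (constraints E) β
    covered β βy N⊆dom with violates-or-other-one β (E w) _ N⊆dom (partner-adjacent layered i b) βy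
    ... | inj₁ w-violated = violated (inj₁ w) w-violated
    ... | inj₂ ((j , c) , Ez , z≢y , βz)
      rewrite other-neighbour-below layered (partner-adjacent layered i b) Ez z≢y = one-below c β βz

  one-in-layer : ∀ p → OneInLayer p
  one-in-layer = <-weakInduction OneInLayer one-in-layer-zero one-in-layer-suc

βℓ-at : ∀ {ℓ m} (x : Fin m) → βℓ x (fromℕ ℓ , x) ≡ just true
βℓ-at {ℓ} x with (fromℕ ℓ , x) ≟V (fromℕ ℓ , x)
... | yes _    = refl
... | no x≢x = contradiction refl x≢x

lemma5p15 : (ℓ m k : ℕ) (E : Edges ℓ m) → IsLayered ℓ m E
    → (∀ w → deg E w ≤ k)
    → (x : Fin m)
    → LayeredGame.FalsifierWins ℓ m k (constraints E) (βℓ x)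
lemma5p15 ℓ m k E layered deg≤k x =
  one-in-layer layered deg≤k (fromℕ ℓ) x (βℓ x) (βℓ-at x)
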